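{- For $i\in\{1,2\}$, let $T_i$ be a finite rooted tree with root $r_i$, where $T_1$ and $T_2$ have disjoint vertex sets, and let $S_i$ be a serialization of $T_i$ with $\operatorname{dcw}(S_i)=\operatorname{dcw}(T_i)=:w_i$. Let $C_1,\ldots,C_\ell$ be the direct child subtrees below $r_1$ in $T_1$ (the subtrees rooted at the children of $r_1$), ordered so that $\operatorname{dcw}(C_1)\le\cdots\le\operatorname{dcw}(C_\ell)$, and assume $w_2\ge\operatorname{dcw}(C_i)$ for all $1\le i\le\ell$. Let $T$ be the tree obtained from $T_1$ by adding $T_2$ as an additional direct child subtree below $r_1$ (i.e., taking the disjoint union of $T_1$ and $T_2$ and adding the edge $\langle r_1,r_2\rangle$). Then $\operatorname{dcw}(T)=\max(w_1+1,w_2)$, and the concatenation $S_1S_2$ is a serialization of $T$ with $\operatorname{dcw}(S_1S_2)=\operatorname{dcw}(T)$.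
   Context: A tree $T=\langle V,E\rangle$ is a finite rooted tree whose directed edges $E$ point from parents to children (towards the leaves). A serialization of $T$ is a word $S\in V^*$ containing each vertex $v\in V$ exactly once, at position $v_S\in\{1,\ldots,|V|\}$, such that $\langle v,w\rangle\in E$ implies $v_S<w_S$. For $i\in\{1,\ldots,|V|-1\}$, the number of edges cut in the $i$th gap is $\operatorname{cut}(i)=|\{\langle v,w\rangle\in E\mid v_S\le i<w_S\}|$. The cutwidth of $S$ is $\operatorname{dcw}(S)=\max_{1\le i<|V|}\operatorname{cut}(i)$ (taken to be $0$ if $|V|=1$), and the directed cutwidth $\operatorname{dcw}(T)$ of $T$ is the minimum of $\operatorname{dcw}(S)$ over all serializations $S$ of $T$. -}

module Defs where

open import Data.Nat using (ℕ; zero; suc; _≤_; _<_; _∸_; _⊔_; _≡ᵇ_; _≤?_; _<?_)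
open import Data.Bool using (if_then_else_)
open import Data.List using (List; []; _∷_; _++_; map; length; foldr; upTo; filter)
open import Data.Product using (_×_; _,_; proj₁; proj₂; ∃)
open import Data.List.Membership.Propositional using (_∈_)
open import Data.List.Relation.Unary.Unique.Propositional using (Unique)
open import Data.List.Relation.Binary.Permutation.Propositional using (_↭_)
open import Relation.Nullary.Decidable using (_×-dec_)
open import Relation.Binary.PropositionalEquality using (_≡_)

data Tree : Set where
  node : ℕ → List Tree → Tree

root : Tree → ℕ
root (node r _) = r

children : Tree → List Tree
children (node _ ts) = ts

mutual
  vertices : Tree → List ℕ
  vertices (node r ts) = r ∷ verticesF ts

  verticesF : List Tree → List ℕ
  verticesF [] = []
  verticesF (t ∷ ts) = vertices t ++ verticesF ts

mutual
  edges : Tree → List (ℕ × ℕ)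
  edges (node r ts) = map (λ t → (r , root t)) ts ++ edgesF ts

  edgesF : List Tree → List (ℕ × ℕ)
  edgesF [] = []
  edgesF (t ∷ ts) = edges t ++ edgesF ts

WellFormed : Tree → Set
WellFormed t = Unique (vertices t)

-- 1-based position of v in the word S (first occurrence)
pos : List ℕ → ℕ → ℕ
pos [] v = 0
pos (x ∷ xs) v = if x ≡ᵇ v then 1 else suc (pos xs v)

Serialization : Tree → List ℕ → Set
Serialization T S =
  (S ↭ vertices T) × (∀ v w → (v , w) ∈ edges T → pos S v < pos S w)

cut : Tree → List ℕ → ℕ → ℕ
cut T S i = length (filter (λ e → (pos S (proj₁ e) ≤? i) ×-dec (i <? pos S (proj₂ e))) (edges T))

-- dcw(S) = max over 1 ≤ i < |V| of cut(i)  (0 if |V| = 1)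
dcwS : Tree → List ℕ → ℕ
dcwS T S = foldr _⊔_ 0 (map (λ i → cut T S (suc i)) (upTo (length (vertices T) ∸ 1)))

IsDCW : Tree → ℕ → Set
IsDCW T w = (∃ λ S → Serialization T S × dcwS T S ≡ w) × (∀ S → Serialization T S → w ≤ dcwS T S)

attach : Tree → Tree → Tree
attach (node r ts) T₂ = node r (ts ++ (T₂ ∷ []))

{-# OPTIONS --safe #-}
module Submission where

-- A gap i of a serialization S cuts exactly the edges leaving the prefix take i S.
--
-- Upper bound: a gap inside S₁ cuts at most w₁ edges of T₁ plus the new edge ⟨r₁,r₂⟩; a gap
-- inside S₂ cuts no edge of T₁ and at most max(w₂,1) edges of the branch ⟨r₁,r₂⟩ ∪ T₂.
--
-- Lower bound: let S serialize T.  Restricting S to T₂ gives a gap p of S at which the branch of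
-- T₂ is cut at least max(w₂,1) times; each of the u children of r₁ not yet finished at p adds a
-- cut edge, so dcw(S) ≥ max(w₂,1) + u.  Serialize T₁ by S* = A R, where A is the prefix of S
-- of length p restricted to r₁ and the finished children, and R concatenates optimal
-- serializations of the unfinished children, each of width ≤ w₂ by hypothesis.  A gap inside A
-- cuts fewer edges than the corresponding gap of S, which in addition cuts an edge into the
-- unfinished T₂; a gap inside R cuts at most max(w₂,1) edges of the current child and one edge
-- to each later child, fewer than max(w₂,1) + u.  Hence w₁ ≤ dcw(S*) < dcw(S).

open import Defs
open import Data.Nat using (ℕ; zero; suc; _+_; _≤_; _<_; _⊔_; _≡ᵇ_; _<?_; _≟_; z≤n; s≤s; >-nonZero)
open import Data.Nat.Properties
open import Data.Bool using (true; false)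
import Data.Bool as Bool
open import Data.Empty using (⊥-elim)
open import Data.List using (List; []; _∷_; _++_; map; length; foldr; filter; take; drop; concatMap)
open import Data.List.Extrema.Nat using (argmin; argmin-all; f[argmin]≤f[xs])
open import Data.List.Membership.DecPropositional _≟_ using (_∈?_)
open import Data.List.Membership.Propositional using (_∈_; _∉_; find; lose)
open import Data.List.Membership.Propositional.Properties
  using (∈-∃++; ∈-++⁺ˡ; ∈-++⁺ʳ; ∈-++⁻; ∈-filter⁺; ∈-filter⁻; ∈-map⁺; ∈-map⁻; ∈-upTo⁺; ∈-upTo⁻;
         ∈-concatMap⁺; ∈-concatMap⁻)
open import Data.List.Membership.Propositional.Properties.WithK using (unique∧set⇒bag)
open import Data.List.Properties
  using (≡-dec; take-take; length-take; length-++; ++-identityʳ; ++-assoc; take++drop≡id;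
         length-filter; filter-++; filter-none; filter-accept; filter-reject)
open import Data.List.Relation.Binary.BagAndSetEquality using (∼bag⇒↭)
open import Data.List.Relation.Binary.Disjoint.Propositional using (Disjoint)
open import Data.List.Relation.Binary.Permutation.Propositional
  using (_↭_; ↭-refl; ↭-reflexive; ↭-trans; ↭-sym; prep; ↭⇒↭ₛ; module PermutationReasoning)
import Data.List.Relation.Binary.Permutation.Propositional as ↭
open import Data.List.Relation.Binary.Permutation.Propositional.Properties
  using (filter-↭; ↭-length; ∈-resp-↭; ++⁺; ++⁺ˡ; ++⁺ʳ; shift; shifts)
import Data.List.Relation.Binary.Permutation.Setoid.Properties as PermutationSetoid
open import Data.List.Relation.Binary.Pointwise using (Pointwise-≡⇒≡)
open import Data.List.Relation.Unary.All using (All; []; _∷_)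
import Data.List.Relation.Unary.All as All
open import Data.List.Relation.Unary.All.Properties using (¬All⇒Any¬; all-filter; ++⁻ˡ; ++⁻ʳ)
open import Data.List.Relation.Unary.AllPairs using ([]; _∷_)
open import Data.List.Relation.Unary.Any using (here; there)
open import Data.List.Relation.Unary.Sorted.TotalOrder.Properties using (↗↭↗⇒≋)
open import Data.List.Relation.Unary.Unique.Propositional using (Unique)
import Data.List.Relation.Unary.Unique.Propositional.Properties as Unique
open import Data.List.Sort ≤-decTotalOrder using (sort; sort-↭; sort-↗)
open import Data.Product using (Σ; _×_; _,_; proj₁; proj₂; ∃; ∃₂)
import Data.Product as Product
open import Data.Sum using (_⊎_; inj₁; inj₂; [_,_])
open import Data.Unit using (tt)
open import Function using (_∘_; _⇔_; mk⇔; Equivalence)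
open import Relation.Binary.PropositionalEquality
  using (_≡_; _≢_; refl; sym; trans; cong; cong₂; subst; subst₂; setoid; module ≡-Reasoning)
open import Relation.Nullary using (¬_; Dec; yes; no; ¬?; contradiction)
open import Relation.Nullary.Decidable using (_×-dec_; map′)
open import Relation.Unary using (Decidable)

open Equivalence using (to; from)

module _ {A : Set} where

  ∈-take⁻ : ∀ i (xs : List A) {x} → x ∈ take i xs → x ∈ xs
  ∈-take⁻ i xs x∈ = subst (_ ∈_) (take++drop≡id i xs) (∈-++⁺ˡ x∈)

  ∈-tail : ∀ {x u} {xs : List A} → x ≢ u → u ∈ x ∷ xs → u ∈ xs
  ∈-tail x≢u (here u≡x) = ⊥-elim (x≢u (sym u≡x))
  ∈-tail x≢u (there u∈) = u∈

  ∈⇒length>0 : ∀ {x} {xs : List A} → x ∈ xs → 0 < length xs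
  ∈⇒length>0 (here _)  = s≤s z≤n
  ∈⇒length>0 (there _) = s≤s z≤n

  take-++ˡ : ∀ {i} (xs ys : List A) → i ≤ length xs → take i (xs ++ ys) ≡ take i xs
  take-++ˡ {zero}  xs       ys _         = refl
  take-++ˡ {suc i} (x ∷ xs) ys (s≤s i≤) = cong (x ∷_) (take-++ˡ xs ys i≤)

  take-++ʳ : ∀ k (xs ys : List A) → take (length xs + k) (xs ++ ys) ≡ xs ++ take k ys
  take-++ʳ k []       ys = refl
  take-++ʳ k (x ∷ xs) ys = cong (x ∷_) (take-++ʳ k xs ys)

  filter-cong : {P Q : A → Set} (P? : Decidable P) (Q? : Decidable Q) (xs : List A)
    → (∀ {x} → x ∈ xs → P x ⇔ Q x) → filter P? xs ≡ filter Q? xs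
  filter-cong P? Q? []       P⇔Q = refl
  filter-cong P? Q? (x ∷ xs) P⇔Q with P? x | Q? x
  ... | yes _  | yes _  = cong (x ∷_) (filter-cong P? Q? xs (P⇔Q ∘ there))
  ... | yes px | no ¬qx = ⊥-elim (¬qx (to (P⇔Q (here refl)) px))
  ... | no ¬px | yes qx = ⊥-elim (¬px (from (P⇔Q (here refl)) qx))
  ... | no _   | no _   = filter-cong P? Q? xs (P⇔Q ∘ there)

  take-filter : {P : A → Set} (P? : Decidable P) (xs : List A) {j : ℕ} → j < length (filter P? xs)
    → ∃ λ G → G < length xs × j ≤ G × take j (filter P? xs) ≡ filter P? (take G xs)
  take-filter P? (x ∷ xs) {zero}  _ = 0 , s≤s z≤n , z≤n , refl
  take-filter P? (x ∷ xs) {suc j} j< with P? x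
  ... | yes px = let G , G< , j≤G , eq = take-filter P? xs (≤-pred j<)
                 in suc G , s≤s G< , s≤s j≤G , trans (cong (x ∷_) eq) (sym (filter-accept P? px))
  ... | no ¬px = let G , G< , j≤G , eq = take-filter P? xs j<
                 in suc G , s≤s G< , m≤n⇒m≤1+n j≤G , trans eq (sym (filter-reject P? ¬px))

  filter-partition-↭ : ∀ {P : A → Set} (P? : Decidable P) xs → xs ↭ filter P? xs ++ filter (¬? ∘ P?) xs
  filter-partition-↭ P? []       = ↭-refl
  filter-partition-↭ P? (x ∷ xs) with P? x
  ... | yes _ = prep x (filter-partition-↭ P? xs)
  ... | no _  = ↭-trans (prep x (filter-partition-↭ P? xs)) (↭-sym (shift x (filter P? xs) _))

  take-take-≤ : ∀ {i j} (xs : List A) → i ≤ j → take i (take j xs) ≡ take i xs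
  take-take-≤ {i} {j} xs i≤j = trans (take-take i j xs) (cong (λ n → take n xs) (m≤n⇒m⊓n≡m i≤j))

  ∈-take-≤ : ∀ {i j} (xs : List A) {x} → i ≤ j → x ∈ take i xs → x ∈ take j xs
  ∈-take-≤ {i} {j} xs i≤j x∈ = ∈-take⁻ i (take j xs) (subst (_ ∈_) (sym (take-take-≤ xs i≤j)) x∈)

  Unique-++⁻ : ∀ xs {ys : List A} → Unique (xs ++ ys) → Unique xs × Unique ys × Disjoint xs ys
  Unique-++⁻ []       ys!        = [] , ys! , λ ()
  Unique-++⁻ (x ∷ xs) (x∉ ∷ xs!) = let xs! , ys! , xs∩ys=∅ = Unique-++⁻ xs xs! in
    ++⁻ˡ xs x∉ ∷ xs! , ys! , λ where
      (here refl , x∈ys) → All.lookup (++⁻ʳ xs x∉) x∈ys refl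
      (there x∈xs , x∈ys) → xs∩ys=∅ (x∈xs , x∈ys)

  Unique-resp-↭ : ∀ {xs ys : List A} → xs ↭ ys → Unique xs → Unique ys
  Unique-resp-↭ xs↭ys = PermutationSetoid.Unique-resp-↭ (setoid A) (↭⇒↭ₛ xs↭ys)

  unique-↭ : ∀ {xs ys : List A} → Unique xs → Unique ys → (∀ {x} → x ∈ xs ⇔ x ∈ ys) → xs ↭ ys
  unique-↭ xs! ys! xs⇔ys = ∼bag⇒↭ (unique∧set⇒bag xs! ys! xs⇔ys)

concatMap-↭ : ∀ {A B : Set} (f : A → List B) {xs ys} → xs ↭ ys → concatMap f xs ↭ concatMap f ys
concatMap-↭ f ↭.refl           = ↭-refl
concatMap-↭ f (↭.prep x p)     = ++⁺ˡ (f x) (concatMap-↭ f p)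
concatMap-↭ f (↭.swap x y p)   = ↭-trans (shifts (f x) (f y)) (++⁺ˡ (f y) (++⁺ˡ (f x) (concatMap-↭ f p)))
concatMap-↭ f (↭.trans p q)    = ↭-trans (concatMap-↭ f p) (concatMap-↭ f q)

concatMap-++ : ∀ {A B : Set} (f : A → List B) xs ys → concatMap f (xs ++ ys) ≡ concatMap f xs ++ concatMap f ys
concatMap-++ f []       ys = refl
concatMap-++ f (x ∷ xs) ys = trans (cong (f x ++_) (concatMap-++ f xs ys)) (sym (++-assoc (f x) _ _))

data Split (m : ℕ) : ℕ → Set where
  below : ∀ {i} → i < m → Split m i
  above : ∀ k → Split m (m + k)

split : ∀ m i → Split m i
split zero    i       = above i
split (suc m) zero    = below (s≤s z≤n)
split (suc m) (suc i) with split m i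
... | below i<m = below (s≤s i<m)
... | above k   = above k

≤-max : ∀ {x} xs → x ∈ xs → x ≤ foldr _⊔_ 0 xs
≤-max (y ∷ xs) (here refl) = m≤m⊔n y _
≤-max (y ∷ xs) (there x∈)  = ≤-trans (≤-max xs x∈) (m≤n⊔m y _)

max-lub : ∀ {k} xs → (∀ {x} → x ∈ xs → x ≤ k) → foldr _⊔_ 0 xs ≤ k
max-lub []       ≤k = z≤n
max-lub (y ∷ xs) ≤k = ⊔-lub (≤k (here refl)) (max-lub xs (≤k ∘ there))

max-attained : ∀ xs → 0 < foldr _⊔_ 0 xs → foldr _⊔_ 0 xs ∈ xs
max-attained (y ∷ xs) 0<max with ⊔-sel y (foldr _⊔_ 0 xs)
... | inj₁ ≡y = here ≡y
... | inj₂ ≡m rewrite ≡m = there (max-attained xs 0<max)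

pos-head : ∀ x xs → pos (x ∷ xs) x ≡ 1
pos-head x xs with x ≡ᵇ x in eq
... | true  = refl
... | false = ⊥-elim (subst Bool.T eq (≡⇒≡ᵇ x x refl))

pos-tail : ∀ {x} xs {u} → x ≢ u → pos (x ∷ xs) u ≡ suc (pos xs u)
pos-tail {x} xs {u} x≢u with x ≡ᵇ u in eq
... | true  = ⊥-elim (x≢u (≡ᵇ⇒≡ x u (subst Bool.T (sym eq) tt)))
... | false = refl

pos-bounds : ∀ S {u} → u ∈ S → 0 < pos S u × pos S u ≤ length S
pos-bounds (x ∷ xs) {u} u∈ with x ≟ u
... | yes refl rewrite pos-head x xs = s≤s z≤n , s≤s z≤n
... | no x≢u rewrite pos-tail xs x≢u = s≤s z≤n , s≤s (proj₂ (pos-bounds xs (∈-tail x≢u u∈)))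

pos≤⇒∈-take : ∀ S {u} i → u ∈ S → pos S u ≤ i → u ∈ take i S
pos≤⇒∈-take S zero u∈ pos≤0 = ⊥-elim (<⇒≱ (proj₁ (pos-bounds S u∈)) pos≤0)
pos≤⇒∈-take (x ∷ xs) {u} (suc i) u∈ pos≤ with x ≟ u
... | yes refl = here refl
... | no x≢u rewrite pos-tail xs x≢u = there (pos≤⇒∈-take xs i (∈-tail x≢u u∈) (≤-pred pos≤))

∈-take⇒pos≤ : ∀ S {u} i → u ∈ take i S → pos S u ≤ i
∈-take⇒pos≤ (x ∷ xs) {u} (suc i) u∈ with x ≟ u
... | yes refl rewrite pos-head x xs = s≤s z≤n
... | no x≢u rewrite pos-tail xs x≢u = s≤s (∈-take⇒pos≤ xs i (∈-tail x≢u u∈))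

pos-++ˡ : ∀ xs ys {u} → u ∈ xs → pos (xs ++ ys) u ≡ pos xs u
pos-++ˡ (x ∷ xs) ys {u} u∈ with x ≟ u
... | yes refl rewrite pos-head x (xs ++ ys) | pos-head x xs = refl
... | no x≢u rewrite pos-tail (xs ++ ys) x≢u | pos-tail xs x≢u = cong suc (pos-++ˡ xs ys (∈-tail x≢u u∈))

pos-++ʳ : ∀ xs ys {u} → u ∉ xs → pos (xs ++ ys) u ≡ length xs + pos ys u
pos-++ʳ []       ys u∉ = refl
pos-++ʳ (x ∷ xs) ys {u} u∉ with x ≟ u
... | yes refl = ⊥-elim (u∉ (here refl))
... | no x≢u rewrite pos-tail (xs ++ ys) x≢u = cong suc (pos-++ʳ xs ys (u∉ ∘ there))

pos-take : ∀ i S {u} → u ∈ take i S → pos (take i S) u ≡ pos S u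
pos-take i S {u} u∈ = trans (sym (pos-++ˡ (take i S) (drop i S) u∈)) (cong (λ S′ → pos S′ u) (take++drop≡id i S))

pos-++-< : ∀ xs ys {u v} → u ∈ xs → v ∉ xs → v ∈ ys → pos (xs ++ ys) u < pos (xs ++ ys) v
pos-++-< xs ys {u} {v} u∈ v∉ v∈ rewrite pos-++ˡ xs ys u∈ | pos-++ʳ xs ys v∉ =
  ≤-<-trans (proj₂ (pos-bounds xs u∈)) (m<m+n (length xs) (proj₁ (pos-bounds ys v∈)))

pos-filter-< : ∀ {P : ℕ → Set} (P? : Decidable P) S {u v} → u ∈ S → v ∈ S → P u → P v
  → pos S u < pos S v → pos (filter P? S) u < pos (filter P? S) v
pos-filter-< P? (x ∷ xs) {u} {v} u∈ v∈ pu pv lt with x ≟ u | x ≟ v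
... | yes refl | yes refl = ⊥-elim (<-irrefl refl lt)
... | no x≢u   | yes refl rewrite pos-head x xs | pos-tail xs x≢u = ⊥-elim (n≮0 (≤-pred lt))
... | yes refl | no x≢v rewrite filter-accept P? {xs = xs} pu | pos-head x (filter P? xs) | pos-tail (filter P? xs) x≢v =
  s≤s (proj₁ (pos-bounds (filter P? xs) (∈-filter⁺ P? (∈-tail x≢v v∈) pv)))
... | no x≢u   | no x≢v rewrite pos-tail xs x≢u | pos-tail xs x≢v with P? x
... | yes px rewrite pos-tail (filter P? xs) x≢u | pos-tail (filter P? xs) x≢v =
  s≤s (pos-filter-< P? xs (∈-tail x≢u u∈) (∈-tail x≢v v∈) pu pv (≤-pred lt))
... | no _ = pos-filter-< P? xs (∈-tail x≢u u∈) (∈-tail x≢v v∈) pu pv (≤-pred lt)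

forward-gap : ∀ S {u v} → u ∈ S → v ∈ S → pos S u < pos S v
  → 0 < pos S u × pos S u < length S × u ∈ take (pos S u) S × v ∉ take (pos S u) S
forward-gap S u∈ v∈ u<v = proj₁ (pos-bounds S u∈) , <-≤-trans u<v (proj₂ (pos-bounds S v∈)) ,
  pos≤⇒∈-take S _ u∈ ≤-refl , λ v∈take → <⇒≱ u<v (∈-take⇒pos≤ S _ v∈take)

-- Edges leaving a set of vertices

Leaves : List ℕ → ℕ × ℕ → Set
Leaves X e = proj₁ e ∈ X × proj₂ e ∉ X

leaves? : ∀ X → Decidable (Leaves X)
leaves? X e = (proj₁ e ∈? X) ×-dec ¬? (proj₂ e ∈? X)

cutSize : List ℕ → List (ℕ × ℕ) → ℕ
cutSize X E = length (filter (leaves? X) E)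

AgreeOn : List ℕ → List ℕ → List ℕ → Set
AgreeOn V X Y = ∀ {x} → x ∈ V → x ∈ X ⇔ x ∈ Y

Within : List (ℕ × ℕ) → List ℕ → Set
Within E V = ∀ {e} → e ∈ E → proj₁ e ∈ V × proj₂ e ∈ V

AgreeOn-++ : ∀ {V A Y} → (∀ {x} → x ∈ V → x ∉ A) → AgreeOn V (A ++ Y) Y
AgreeOn-++ {A = A} V∩A=∅ x∈V = mk⇔ ([ ⊥-elim ∘ V∩A=∅ x∈V , (λ x∈Y → x∈Y) ] ∘ ∈-++⁻ A) (∈-++⁺ʳ A)

AgreeOn-filter : ∀ V X → AgreeOn V (filter (_∈? V) X) X
AgreeOn-filter V X x∈V = mk⇔ (proj₁ ∘ ∈-filter⁻ (_∈? V) {xs = X}) (λ x∈X → ∈-filter⁺ (_∈? V) x∈X x∈V)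

cutSize-++ : ∀ X E F → cutSize X (E ++ F) ≡ cutSize X E + cutSize X F
cutSize-++ X E F = trans (cong length (filter-++ (leaves? X) E F)) (length-++ (filter (leaves? X) E))

cutSize-↭ : ∀ X {E F} → E ↭ F → cutSize X E ≡ cutSize X F
cutSize-↭ X E↭F = ↭-length (filter-↭ (leaves? X) E↭F)

cutSize≤length : ∀ X E → cutSize X E ≤ length E
cutSize≤length X E = length-filter (leaves? X) E

cutSize≡0 : ∀ X E → (∀ {e} → e ∈ E → ¬ Leaves X e) → cutSize X E ≡ 0
cutSize≡0 X E none = cong length (filter-none (leaves? X) (All.tabulate none))

cutSize>0 : ∀ X {E e} → e ∈ E → Leaves X e → 0 < cutSize X E
cutSize>0 X e∈ leaves = ∈⇒length>0 (∈-filter⁺ (leaves? X) e∈ leaves)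

cutSize>0⇒Leaves : ∀ X E → 0 < cutSize X E → ∃ λ e → e ∈ E × Leaves X e
cutSize>0⇒Leaves X E _ with filter (leaves? X) E in eq
... | e ∷ _ = e , ∈-filter⁻ (leaves? X) (subst (e ∈_) (sym eq) (here refl))

cutSize-cong : ∀ {V X Y} E → Within E V → AgreeOn V X Y → cutSize X E ≡ cutSize Y E
cutSize-cong {V} {X} {Y} E within agree = cong length (filter-cong (leaves? X) (leaves? Y) E leaves⇔)
  where
  leaves⇔ : ∀ {e} → e ∈ E → Leaves X e ⇔ Leaves Y e
  leaves⇔ e∈ = let u∈V , v∈V = within e∈ in
    mk⇔ (λ (u∈X , v∉X) → to (agree u∈V) u∈X , v∉X ∘ from (agree v∈V))
        (λ (u∈Y , v∉Y) → from (agree u∈V) u∈Y , v∉Y ∘ to (agree v∈V))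

branch : ℕ → Tree → List (ℕ × ℕ)
branch r C = (r , root C) ∷ edges C

branches : ℕ → List Tree → List (ℕ × ℕ)
branches r = concatMap (branch r)

edges↭branches : ∀ r ts → edges (node r ts) ↭ branches r ts
edges↭branches r []       = ↭-refl
edges↭branches r (C ∷ ts) = prep (r , root C)
  (↭-trans (shifts (map (λ t → r , root t) ts) (edges C)) (++⁺ˡ (edges C) (edges↭branches r ts)))

verticesF≡concatMap : ∀ ts → verticesF ts ≡ concatMap vertices ts
verticesF≡concatMap []       = refl
verticesF≡concatMap (C ∷ ts) = cong (vertices C ++_) (verticesF≡concatMap ts)

verticesF-++ : ∀ ts us → verticesF (ts ++ us) ≡ verticesF ts ++ verticesF us
verticesF-++ []       us = refl
verticesF-++ (C ∷ ts) us = trans (cong (vertices C ++_) (verticesF-++ ts us)) (sym (++-assoc (vertices C) _ _))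

verticesF-↭ : ∀ {ts us} → ts ↭ us → verticesF ts ↭ verticesF us
verticesF-↭ {ts} {us} ts↭us =
  subst₂ _↭_ (sym (verticesF≡concatMap ts)) (sym (verticesF≡concatMap us)) (concatMap-↭ vertices ts↭us)

∈-edges⁻ : ∀ {r ts e} → e ∈ edges (node r ts) → ∃ λ C → C ∈ ts × e ∈ branch r C
∈-edges⁻ {r} {ts} e∈ = find (∈-concatMap⁻ (branch r) (∈-resp-↭ (edges↭branches r ts) e∈))

∈-edges⁺ : ∀ {r ts e C} → C ∈ ts → e ∈ branch r C → e ∈ edges (node r ts)
∈-edges⁺ {r} {ts} C∈ e∈ = ∈-resp-↭ (↭-sym (edges↭branches r ts)) (∈-concatMap⁺ (branch r) (lose C∈ e∈))

∈-verticesF⁻ : ∀ {ts x} → x ∈ verticesF ts → ∃ λ C → C ∈ ts × x ∈ vertices C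
∈-verticesF⁻ {ts} x∈ = find (∈-concatMap⁻ vertices (subst (_ ∈_) (verticesF≡concatMap ts) x∈))

∈-verticesF⁺ : ∀ {ts x C} → C ∈ ts → x ∈ vertices C → x ∈ verticesF ts
∈-verticesF⁺ {ts} C∈ x∈ = subst (_ ∈_) (sym (verticesF≡concatMap ts)) (∈-concatMap⁺ vertices (lose C∈ x∈))

root∈vertices : ∀ T → root T ∈ vertices T
root∈vertices (node r ts) = here refl

mutual
  edges-within : ∀ T → Within (edges T) (vertices T)
  edges-within (node r ts) e∈ with ∈-++⁻ (map (λ t → r , root t) ts) e∈
  ... | inj₂ e∈F = Product.map there there (edgesF-within ts e∈F)
  ... | inj₁ e∈map with ∈-map⁻ (λ t → r , root t) e∈map
  ...   | C , C∈ , refl = here refl , there (∈-verticesF⁺ C∈ (root∈vertices C))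

  edgesF-within : ∀ ts → Within (edgesF ts) (verticesF ts)
  edgesF-within (C ∷ ts) e∈ with ∈-++⁻ (edges C) e∈
  ... | inj₁ e∈C  = Product.map ∈-++⁺ˡ ∈-++⁺ˡ (edges-within C e∈C)
  ... | inj₂ e∈ts = Product.map (∈-++⁺ʳ (vertices C)) (∈-++⁺ʳ (vertices C)) (edgesF-within ts e∈ts)

branch-target : ∀ r C {e} → e ∈ branch r C → proj₂ e ∈ vertices C
branch-target r C (here refl) = root∈vertices C
branch-target r C (there e∈)  = proj₂ (edges-within C e∈)

edges-node-⊆ : ∀ {r us ts e} → (∀ {C} → C ∈ us → C ∈ ts) → e ∈ edges (node r us) → e ∈ edges (node r ts)
edges-node-⊆ us⊆ts e∈ = let C , C∈ , e∈C = ∈-edges⁻ e∈ in ∈-edges⁺ (us⊆ts C∈) e∈C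

mutual
  parent : ∀ T {x} → x ∈ vertices T → x ≢ root T → ∃ λ p → (p , x) ∈ edges T
  parent (node r ts) (here refl) x≢r = ⊥-elim (x≢r refl)
  parent (node r ts) (there x∈)  _   = let C , p , C∈ , e∈ = parentF r ts x∈ in p , ∈-edges⁺ C∈ e∈

  parentF : ∀ r ts {x} → x ∈ verticesF ts → ∃₂ λ C p → C ∈ ts × (p , x) ∈ branch r C
  parentF r (C ∷ ts) {x} x∈ with ∈-++⁻ (vertices C) x∈
  ... | inj₂ x∈ts = let D , p , D∈ , e∈ = parentF r ts x∈ts in D , p , there D∈ , e∈
  ... | inj₁ x∈C with x ≟ root C
  ...   | yes refl = C , r , here refl , here refl
  ...   | no x≢rC  = let p , e∈ = parent C x∈C x≢rC in C , p , here refl , there e∈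

mutual
  exit-edge : ∀ {X} r C {x} → r ∈ X → x ∈ vertices C → x ∉ X → ∃ λ e → e ∈ branch r C × Leaves X e
  exit-edge {X} r (node c cs) r∈ x∈ x∉ with c ∈? X
  ... | no c∉ = (r , c) , here refl , r∈ , c∉
  ... | yes c∈ with x∈
  ...   | here refl = ⊥-elim (x∉ c∈)
  ...   | there x∈cs = let D , e , D∈ , e∈ , leaves = exit-edgeF c cs c∈ x∈cs x∉
                       in e , there (∈-edges⁺ D∈ e∈) , leaves

  exit-edgeF : ∀ {X} c cs {x} → c ∈ X → x ∈ verticesF cs → x ∉ X
    → ∃₂ λ D e → D ∈ cs × e ∈ branch c D × Leaves X e
  exit-edgeF c (D ∷ cs) c∈ x∈ x∉ with ∈-++⁻ (vertices D) x∈
  ... | inj₁ x∈D  = let e , e∈ , leaves = exit-edge c D c∈ x∈D x∉ in D , e , here refl , e∈ , leaves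
  ... | inj₂ x∈cs = let D′ , e , D′∈ , e∈ , leaves = exit-edgeF c cs c∈ x∈cs x∉
                    in D′ , e , there D′∈ , e∈ , leaves

child-wellFormed : ∀ {r ts C} → WellFormed (node r ts) → C ∈ ts → WellFormed C
child-wellFormed {ts = ts} {C} (_ ∷ ts!) C∈ with ∈-∃++ C∈
... | xs , ys , refl = proj₁ (Unique-++⁻ (vertices C)
                        (proj₁ (proj₂ (Unique-++⁻ (verticesF xs) (subst Unique (verticesF-++ xs (C ∷ ys)) ts!)))))

Forward : List (ℕ × ℕ) → List ℕ → Set
Forward E S = ∀ v w → (v , w) ∈ E → pos S v < pos S w

module _ {T : Tree} {S : List ℕ} (ser : Serialization T S) where

  ∈-serialization : ∀ {x} → x ∈ vertices T → x ∈ S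
  ∈-serialization = ∈-resp-↭ (↭-sym (proj₁ ser))

  serialization-length : length S ≡ length (vertices T)
  serialization-length = ↭-length (proj₁ ser)

  serialization-unique : WellFormed T → Unique S
  serialization-unique = Unique-resp-↭ (↭-sym (proj₁ ser))

  cut≡cutSize : ∀ i → cut T S i ≡ cutSize (take i S) (edges T)
  cut≡cutSize i = cong length (filter-cong _ (leaves? (take i S)) (edges T) gap⇔leaves)
    where
    gap⇔leaves : ∀ {e} → e ∈ edges T → (pos S (proj₁ e) ≤ i × i < pos S (proj₂ e)) ⇔ Leaves (take i S) e
    gap⇔leaves e∈ = let u∈ , v∈ = edges-within T e∈ in
      mk⇔ (λ (u≤i , i<v) → pos≤⇒∈-take S i (∈-serialization u∈) u≤i , λ v∈take → <⇒≱ i<v (∈-take⇒pos≤ S i v∈take))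
          (λ (u∈take , v∉take) → ∈-take⇒pos≤ S i u∈take , ≰⇒> (v∉take ∘ pos≤⇒∈-take S i (∈-serialization v∈)))

root-first : ∀ T S → Serialization T S → ∃ λ S′ → S ≡ root T ∷ S′
root-first T [] ser with ∈-serialization ser (root∈vertices T)
... | ()
root-first T (x ∷ S′) ser with x ≟ root T
... | yes refl   = S′ , refl
... | no x≢root with parent T (∈-resp-↭ (proj₁ ser) (here refl)) x≢root
...   | p , p→x = ⊥-elim (<⇒≱ (proj₂ ser p x p→x) (≤-trans (≤-reflexive (pos-head x S′)) 0<pos-p))
  where
  0<pos-p : 0 < pos (x ∷ S′) p
  0<pos-p = proj₁ (pos-bounds (x ∷ S′) (∈-serialization ser (proj₁ (edges-within T p→x))))

root∈take : ∀ {T S} → Serialization T S → ∀ {i} → 0 < i → root T ∈ take i S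
root∈take {T} {S} ser {suc i} _ with root-first T S ser
... | S′ , refl = here refl

restrict : ∀ {S} C → Unique S → WellFormed C → (∀ {x} → x ∈ vertices C → x ∈ S) → Forward (edges C) S
  → Serialization C (filter (_∈? vertices C) S)
restrict {S} C S! C! C⊆S forward =
  unique-↭ (Unique.filter⁺ (_∈? vertices C) S!) C!
    (mk⇔ (proj₂ ∘ ∈-filter⁻ (_∈? vertices C) {xs = S}) (λ x∈ → ∈-filter⁺ (_∈? vertices C) (C⊆S x∈) x∈)) ,
  λ v w e∈ → let v∈ , w∈ = edges-within C e∈ in
    pos-filter-< (_∈? vertices C) S (C⊆S v∈) (C⊆S w∈) v∈ w∈ (forward v w e∈)

cut≤dcwS : ∀ T S {i} → 0 < i → i < length (vertices T) → cut T S i ≤ dcwS T S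
cut≤dcwS (node r ts) S {suc i} _ (s≤s i<) =
  ≤-max _ (∈-map⁺ (λ i → cut (node r ts) S (suc i)) (∈-upTo⁺ i<))

dcwS-lub : ∀ T S {k} → (∀ {i} → 0 < i → i < length (vertices T) → cut T S i ≤ k) → dcwS T S ≤ k
dcwS-lub (node r ts) S ≤k = max-lub _ λ c∈ →
  let i , i∈ , c≡ = ∈-map⁻ (λ i → cut (node r ts) S (suc i)) c∈
  in subst (_≤ _) (sym c≡) (≤k (s≤s z≤n) (s≤s (∈-upTo⁻ i∈)))

dcwS-attained : ∀ T S → 0 < dcwS T S → ∃ λ i → 0 < i × i < length (vertices T) × dcwS T S ≡ cut T S i
dcwS-attained (node r ts) S 0<dcwS =
  let i , i∈ , c≡ = ∈-map⁻ (λ i → cut (node r ts) S (suc i)) (max-attained _ 0<dcwS)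
  in suc i , s≤s z≤n , s≤s (∈-upTo⁻ i∈) , c≡

-- Optimal serializations exist

↭-dec : (xs ys : List ℕ) → Dec (xs ↭ ys)
↭-dec xs ys with ≡-dec _≟_ (sort xs) (sort ys)
... | yes eq = yes (↭-trans (↭-sym (sort-↭ xs)) (subst (_↭ ys) (sym eq) (sort-↭ ys)))
... | no neq = no λ xs↭ys → neq (Pointwise-≡⇒≡ (↗↭↗⇒≋ ≤-totalOrder (sort-↗ xs) (sort-↗ ys)
                 (↭⇒↭ₛ (↭-trans (sort-↭ xs) (↭-trans xs↭ys (↭-sym (sort-↭ ys)))))))

forward? : ∀ E S → Dec (Forward E S)
forward? E S = map′ (λ all v w e∈ → All.lookup all e∈) (λ fwd → All.tabulate λ {e} e∈ → fwd (proj₁ e) (proj₂ e) e∈)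
  (All.all? (λ e → pos S (proj₁ e) <? pos S (proj₂ e)) E)

serialization? : ∀ T → Decidable (Serialization T)
serialization? T S = ↭-dec S (vertices T) ×-dec forward? (edges T) S

words : List ℕ → ℕ → List (List ℕ)
words V zero    = [] ∷ []
words V (suc n) = concatMap (λ x → map (x ∷_) (words V n)) V

∈-words : ∀ V S → (∀ {x} → x ∈ S → x ∈ V) → S ∈ words V (length S)
∈-words V []      _    = here refl
∈-words V (x ∷ S) S⊆V = ∈-concatMap⁺ (λ x → map (x ∷_) (words V (length S)))
  (lose (S⊆V (here refl)) (∈-map⁺ (x ∷_) (∈-words V S (S⊆V ∘ there))))

IsDCW-exists : ∀ T {S₀} → Serialization T S₀ → ∃ (IsDCW T)
IsDCW-exists T {S₀} ser₀ = dcwS T best , (best , best-ser , refl) , best-≤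
  where
  candidates : List (List ℕ)
  candidates = filter (serialization? T) (words (vertices T) (length (vertices T)))
  best : List ℕ
  best = argmin (dcwS T) S₀ candidates
  best-ser : Serialization T best
  best-ser = argmin-all (dcwS T) ser₀ (all-filter (serialization? T) (words (vertices T) (length (vertices T))))
  best-≤ : ∀ S → Serialization T S → dcwS T best ≤ dcwS T S
  best-≤ S ser = All.lookup (f[argmin]≤f[xs] S₀ candidates)
    (∈-filter⁺ (serialization? T) (subst (λ n → S ∈ words (vertices T) n) (serialization-length ser)
      (∈-words (vertices T) S (∈-resp-↭ (proj₁ ser)))) ser)

cutSize-edges≡0 : ∀ {X} T → (∀ {x} → x ∈ vertices T → x ∈ X) → cutSize X (edges T) ≡ 0
cutSize-edges≡0 {X} T T⊆X = cutSize≡0 X (edges T) λ e∈ (_ , v∉X) → v∉X (T⊆X (proj₂ (edges-within T e∈)))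

module _ {X : List ℕ} (r : ℕ) (C : Tree) where

  cutSize-branch : cutSize X (branch r C) ≡ cutSize X ((r , root C) ∷ []) + cutSize X (edges C)
  cutSize-branch = cutSize-++ X ((r , root C) ∷ []) (edges C)

  cutSize-branch≤1 : (∀ {x} → x ∈ vertices C → x ∉ X) → cutSize X (branch r C) ≤ 1
  cutSize-branch≤1 C∩X=∅ = begin
    cutSize X (branch r C)                                  ≡⟨ cutSize-branch ⟩
    cutSize X ((r , root C) ∷ []) + cutSize X (edges C)     ≡⟨ cong (cutSize X ((r , root C) ∷ []) +_) no-inner-edge-leaves ⟩
    cutSize X ((r , root C) ∷ []) + 0                       ≤⟨ +-monoˡ-≤ 0 (cutSize≤length X ((r , root C) ∷ [])) ⟩
    1                                                       ∎
    where
    open ≤-Reasoning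
    no-inner-edge-leaves : cutSize X (edges C) ≡ 0
    no-inner-edge-leaves = cutSize≡0 X (edges C) λ e∈ (u∈X , _) → C∩X=∅ (proj₁ (edges-within C e∈)) u∈X

  cutSize-branch≡0 : (∀ {x} → x ∈ vertices C → x ∈ X) → cutSize X (branch r C) ≡ 0
  cutSize-branch≡0 C⊆X = cutSize≡0 X (branch r C) λ e∈ (_ , v∉X) →
    v∉X (C⊆X (branch-target r C e∈))

  cutSize-branch>0 : ∀ {x} → r ∈ X → x ∈ vertices C → x ∉ X → 0 < cutSize X (branch r C)
  cutSize-branch>0 r∈X x∈C x∉X = let e , e∈ , leaves = exit-edge r C r∈X x∈C x∉X in cutSize>0 X e∈ leaves

  cutSize-branch≤width : ∀ {s k} → Serialization C s → k < length s → AgreeOn (vertices C) X (take k s)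
    → cutSize X (branch r C) ≤ dcwS C s ⊔ 1
  cutSize-branch≤width {s} {zero} ser _ agree =
    ≤-trans (cutSize-branch≤1 λ x∈C x∈X → contradiction (to (agree x∈C) x∈X) λ ()) (m≤n⊔m _ 1)
  cutSize-branch≤width {s} {suc k} ser k< agree = begin
    cutSize X (branch r C)                                  ≡⟨ cutSize-branch ⟩
    cutSize X ((r , root C) ∷ []) + cutSize X (edges C)     ≡⟨ cong₂ _+_ root-edge-inside (cutSize-cong (edges C) (edges-within C) agree) ⟩
    cutSize (take (suc k) s) (edges C)                      ≡⟨ cut≡cutSize ser (suc k) ⟨
    cut C s (suc k)                                         ≤⟨ cut≤dcwS C s (s≤s z≤n) (subst (suc k <_) (serialization-length ser) k<) ⟩
    dcwS C s                                                ≤⟨ m≤m⊔n _ 1 ⟩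
    dcwS C s ⊔ 1                                            ∎
    where
    open ≤-Reasoning
    root-edge-inside : cutSize X ((r , root C) ∷ []) ≡ 0
    root-edge-inside = cutSize≡0 X ((r , root C) ∷ []) λ { (here refl) (_ , rC∉X) →
      rC∉X (from (agree (root∈vertices C)) (root∈take ser (s≤s z≤n))) }

module _ {X : List ℕ} (r : ℕ) where

  cutSize-branches≤length : ∀ Cs → (∀ {C} → C ∈ Cs → cutSize X (branch r C) ≤ 1) → cutSize X (branches r Cs) ≤ length Cs
  cutSize-branches≤length []       _  = z≤n
  cutSize-branches≤length (C ∷ Cs) ≤1 = subst (_≤ length (C ∷ Cs)) (sym (cutSize-++ X (branch r C) (branches r Cs)))
    (+-mono-≤ (≤1 (here refl)) (cutSize-branches≤length Cs (≤1 ∘ there)))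

  length≤cutSize-branches : ∀ Cs → (∀ {C} → C ∈ Cs → 0 < cutSize X (branch r C)) → length Cs ≤ cutSize X (branches r Cs)
  length≤cutSize-branches []       _  = z≤n
  length≤cutSize-branches (C ∷ Cs) >0 = subst (length (C ∷ Cs) ≤_) (sym (cutSize-++ X (branch r C) (branches r Cs)))
    (+-mono-≤ (>0 (here refl)) (length≤cutSize-branches Cs (>0 ∘ there)))

  cutSize-branches≡0 : ∀ Cs → (∀ {C} → C ∈ Cs → cutSize X (branch r C) ≡ 0) → cutSize X (branches r Cs) ≡ 0
  cutSize-branches≡0 []       _  = refl
  cutSize-branches≡0 (C ∷ Cs) ≡0 = trans (cutSize-++ X (branch r C) (branches r Cs))
    (cong₂ _+_ (≡0 (here refl)) (cutSize-branches≡0 Cs (≡0 ∘ there)))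

Serialization≤ : ℕ → Tree → Set
Serialization≤ w C = Σ (List ℕ) λ s → Serialization C s × dcwS C s ≤ w

module _ {w : ℕ} where

  joined : ∀ {Cs} → All (Serialization≤ w) Cs → List ℕ
  joined []             = []
  joined ((s , _) ∷ ss) = s ++ joined ss

  joined-↭ : ∀ {Cs} (ss : All (Serialization≤ w) Cs) → joined ss ↭ verticesF Cs
  joined-↭ []                   = ↭-refl
  joined-↭ ((s , ser , _) ∷ ss) = ++⁺ (proj₁ ser) (joined-↭ ss)

  joined-forward : ∀ {Cs} (ss : All (Serialization≤ w) Cs) → Unique (verticesF Cs)
    → ∀ {C} → C ∈ Cs → Forward (edges C) (joined ss)
  joined-forward ((s , ser , _) ∷ ss) _ (here refl) u v e∈ = let u∈ , v∈ = edges-within _ e∈ in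
    subst₂ _<_ (sym (pos-++ˡ s _ (∈-serialization ser u∈))) (sym (pos-++ˡ s _ (∈-serialization ser v∈))) (proj₂ ser u v e∈)
  joined-forward {D ∷ Cs} ((s , ser , _) ∷ ss) Cs! {C} (there C∈) u v e∈ = let u∈ , v∈ = edges-within C e∈ in
    subst₂ _<_ (sym (pos-++ʳ s _ (∉s u∈))) (sym (pos-++ʳ s _ (∉s v∈)))
      (+-monoʳ-< (length s) (joined-forward ss (proj₁ (proj₂ (Unique-++⁻ (vertices D) Cs!))) C∈ u v e∈))
    where
    ∉s : ∀ {x} → x ∈ vertices C → x ∉ s
    ∉s x∈C x∈s = proj₂ (proj₂ (Unique-++⁻ (vertices D) Cs!)) (∈-resp-↭ (proj₁ ser) x∈s , ∈-verticesF⁺ C∈ x∈C)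

  cutSize-joined : ∀ r {Cs A k} (ss : All (Serialization≤ w) Cs) → Unique (verticesF Cs)
    → (∀ {x} → x ∈ verticesF Cs → x ∉ A) → k < length (joined ss)
    → suc (cutSize (A ++ take k (joined ss)) (branches r Cs)) ≤ w ⊔ 1 + length Cs
  cutSize-joined r {C ∷ Cs} {A} {k} ((s , ser , s≤w) ∷ ss) Cs! Cs∩A=∅ k< with split (length s) k
  ... | below k<s rewrite take-++ˡ s (joined ss) (<⇒≤ k<s) = begin
    suc (cutSize (A ++ take k s) (branches r (C ∷ Cs)))
      ≡⟨ cong suc (cutSize-++ (A ++ take k s) (branch r C) (branches r Cs)) ⟩
    suc (cutSize (A ++ take k s) (branch r C) + cutSize (A ++ take k s) (branches r Cs))
      ≤⟨ s≤s (+-mono-≤ (≤-trans (cutSize-branch≤width r C ser k<s (AgreeOn-++ (Cs∩A=∅ ∘ ∈-++⁺ˡ))) (⊔-monoˡ-≤ 1 s≤w))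
                       (cutSize-branches≤length r Cs λ {D} D∈ → cutSize-branch≤1 r D (outside D∈))) ⟩
    suc (w ⊔ 1 + length Cs)
      ≡⟨ +-suc (w ⊔ 1) (length Cs) ⟨
    w ⊔ 1 + length (C ∷ Cs) ∎
    where
    open ≤-Reasoning
    outside : ∀ {D x} → D ∈ Cs → x ∈ vertices D → x ∉ A ++ take k s
    outside D∈ x∈D x∈ with ∈-++⁻ A x∈
    ... | inj₁ x∈A = Cs∩A=∅ (∈-++⁺ʳ (vertices C) (∈-verticesF⁺ D∈ x∈D)) x∈A
    ... | inj₂ x∈s = proj₂ (proj₂ (Unique-++⁻ (vertices C) Cs!))
                       (∈-resp-↭ (proj₁ ser) (∈-take⁻ k s x∈s) , ∈-verticesF⁺ D∈ x∈D)
  ... | above k′ rewrite take-++ʳ k′ s (joined ss) | sym (++-assoc A s (take k′ (joined ss))) = begin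
    suc (cutSize ((A ++ s) ++ take k′ (joined ss)) (branches r (C ∷ Cs)))
      ≡⟨ cong suc (cutSize-++ _ (branch r C) (branches r Cs)) ⟩
    suc (cutSize ((A ++ s) ++ take k′ (joined ss)) (branch r C) + cutSize ((A ++ s) ++ take k′ (joined ss)) (branches r Cs))
      ≡⟨ cong (λ n → suc (n + _)) (cutSize-branch≡0 r C (∈-++⁺ˡ ∘ ∈-++⁺ʳ A ∘ ∈-serialization ser)) ⟩
    suc (cutSize ((A ++ s) ++ take k′ (joined ss)) (branches r Cs))
      ≤⟨ cutSize-joined r ss (proj₁ (proj₂ (Unique-++⁻ (vertices C) Cs!))) outside k′< ⟩
    w ⊔ 1 + length Cs
      ≤⟨ +-monoʳ-≤ (w ⊔ 1) (n≤1+n (length Cs)) ⟩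
    w ⊔ 1 + length (C ∷ Cs) ∎
    where
    open ≤-Reasoning
    k′< : k′ < length (joined ss)
    k′< = +-cancelˡ-< (length s) k′ _ (subst (length s + k′ <_) (length-++ s) k<)
    outside : ∀ {x} → x ∈ verticesF Cs → x ∉ A ++ s
    outside x∈Cs x∈ with ∈-++⁻ A x∈
    ... | inj₁ x∈A = Cs∩A=∅ (∈-++⁺ʳ (vertices C) x∈Cs) x∈A
    ... | inj₂ x∈s = proj₂ (proj₂ (Unique-++⁻ (vertices C) Cs!)) (∈-resp-↭ (proj₁ ser) x∈s , x∈Cs)

vertices-attach : ∀ T₁ T₂ → vertices (attach T₁ T₂) ≡ vertices T₁ ++ vertices T₂
vertices-attach (node r ts) T₂ =
  cong (r ∷_) (trans (verticesF-++ ts (T₂ ∷ [])) (cong (verticesF ts ++_) (++-identityʳ (vertices T₂))))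

edges-attach : ∀ T₁ T₂ → edges (attach T₁ T₂) ↭ edges T₁ ++ branch (root T₁) T₂
edges-attach (node r ts) T₂ = begin
  edges (node r (ts ++ T₂ ∷ []))       ↭⟨ edges↭branches r (ts ++ T₂ ∷ []) ⟩
  branches r (ts ++ T₂ ∷ [])           ≡⟨ concatMap-++ (branch r) ts (T₂ ∷ []) ⟩
  branches r ts ++ branch r T₂ ++ []   ≡⟨ cong (branches r ts ++_) (++-identityʳ (branch r T₂)) ⟩
  branches r ts ++ branch r T₂         ↭⟨ ++⁺ʳ (branch r T₂) (↭-sym (edges↭branches r ts)) ⟩
  edges (node r ts) ++ branch r T₂     ∎
  where open PermutationReasoning

module _ {T₁ T₂ : Tree} where

  ∈-edges-attach⁻ : ∀ {e} → e ∈ edges (attach T₁ T₂) → e ∈ edges T₁ ⊎ e ∈ branch (root T₁) T₂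
  ∈-edges-attach⁻ = ∈-++⁻ (edges T₁) ∘ ∈-resp-↭ (edges-attach T₁ T₂)

  ∈-edges-attach⁺ : ∀ {e} → e ∈ edges T₁ ⊎ e ∈ branch (root T₁) T₂ → e ∈ edges (attach T₁ T₂)
  ∈-edges-attach⁺ = ∈-resp-↭ (↭-sym (edges-attach T₁ T₂)) ∘ [ ∈-++⁺ˡ , ∈-++⁺ʳ (edges T₁) ]

  ∈-vertices-attach⁺ : ∀ {x} → x ∈ vertices T₁ ⊎ x ∈ vertices T₂ → x ∈ vertices (attach T₁ T₂)
  ∈-vertices-attach⁺ {x} = subst (x ∈_) (sym (vertices-attach T₁ T₂)) ∘ [ ∈-++⁺ˡ , ∈-++⁺ʳ (vertices T₁) ]

  cutSize-attach : ∀ X → cutSize X (edges (attach T₁ T₂)) ≡ cutSize X (edges T₁) + cutSize X (branch (root T₁) T₂)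
  cutSize-attach X = trans (cutSize-↭ X (edges-attach T₁ T₂)) (cutSize-++ X (edges T₁) _)

module _ {T₁ T₂ : Tree} (disjoint : Disjoint (vertices T₁) (vertices T₂))
         {S₁ S₂ : List ℕ} (ser₁ : Serialization T₁ S₁) (ser₂ : Serialization T₂ S₂) where

  private
    ∉S₁ : ∀ {x} → x ∈ vertices T₂ → x ∉ S₁
    ∉S₁ x∈T₂ x∈S₁ = disjoint (∈-resp-↭ (proj₁ ser₁) x∈S₁ , x∈T₂)

  serialization-attach : Serialization (attach T₁ T₂) (S₁ ++ S₂)
  serialization-attach = subst (S₁ ++ S₂ ↭_) (sym (vertices-attach T₁ T₂)) (++⁺ (proj₁ ser₁) (proj₁ ser₂)) , forward
    where
    forward : Forward (edges (attach T₁ T₂)) (S₁ ++ S₂)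
    forward v w e∈ with ∈-edges-attach⁻ {T₁} {T₂} e∈
    ... | inj₁ e∈T₁ = let v∈ , w∈ = edges-within T₁ e∈T₁ in
      subst₂ _<_ (sym (pos-++ˡ S₁ S₂ (∈-serialization ser₁ v∈))) (sym (pos-++ˡ S₁ S₂ (∈-serialization ser₁ w∈)))
        (proj₂ ser₁ v w e∈T₁)
    ... | inj₂ (here refl) =
      pos-++-< S₁ S₂ (∈-serialization ser₁ (root∈vertices T₁)) (∉S₁ (root∈vertices T₂))
        (∈-serialization ser₂ (root∈vertices T₂))
    ... | inj₂ (there e∈T₂) = let v∈ , w∈ = edges-within T₂ e∈T₂ in
      subst₂ _<_ (sym (pos-++ʳ S₁ S₂ (∉S₁ v∈))) (sym (pos-++ʳ S₁ S₂ (∉S₁ w∈)))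
        (+-monoʳ-< (length S₁) (proj₂ ser₂ v w e∈T₂))

  dcwS-attach≤ : dcwS (attach T₁ T₂) (S₁ ++ S₂) ≤ suc (dcwS T₁ S₁) ⊔ dcwS T₂ S₂
  dcwS-attach≤ = dcwS-lub (attach T₁ T₂) (S₁ ++ S₂) λ {i} 0<i i<n → begin
    cut (attach T₁ T₂) (S₁ ++ S₂) i
      ≡⟨ cut≡cutSize serialization-attach i ⟩
    cutSize (take i (S₁ ++ S₂)) (edges (attach T₁ T₂))
      ≡⟨ cutSize-attach {T₁} {T₂} (take i (S₁ ++ S₂)) ⟩
    cutSize (take i (S₁ ++ S₂)) (edges T₁) + cutSize (take i (S₁ ++ S₂)) (branch (root T₁) T₂)
      ≤⟨ gap≤ 0<i (subst (i <_) (sym (serialization-length serialization-attach)) i<n) (split (length S₁) i) ⟩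
    suc (dcwS T₁ S₁) ⊔ dcwS T₂ S₂ ∎
    where
    open ≤-Reasoning
    gap≤ : ∀ {i} → 0 < i → i < length (S₁ ++ S₂) → Split (length S₁) i
      → cutSize (take i (S₁ ++ S₂)) (edges T₁) + cutSize (take i (S₁ ++ S₂)) (branch (root T₁) T₂)
        ≤ suc (dcwS T₁ S₁) ⊔ dcwS T₂ S₂
    gap≤ {i} 0<i _ (below i<S₁) rewrite take-++ˡ S₁ S₂ (<⇒≤ i<S₁) = begin
      cutSize (take i S₁) (edges T₁) + cutSize (take i S₁) (branch (root T₁) T₂)
        ≤⟨ +-mono-≤ (subst (_≤ dcwS T₁ S₁) (cut≡cutSize ser₁ i) (cut≤dcwS T₁ S₁ 0<i (subst (i <_) (serialization-length ser₁) i<S₁)))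
                    (cutSize-branch≤1 (root T₁) T₂ λ x∈T₂ x∈take → ∉S₁ x∈T₂ (∈-take⁻ i S₁ x∈take)) ⟩
      dcwS T₁ S₁ + 1  ≡⟨ +-comm (dcwS T₁ S₁) 1 ⟩
      suc (dcwS T₁ S₁) ≤⟨ m≤m⊔n (suc (dcwS T₁ S₁)) (dcwS T₂ S₂) ⟩
      suc (dcwS T₁ S₁) ⊔ dcwS T₂ S₂ ∎
    gap≤ _ i<n (above k) rewrite take-++ʳ k S₁ S₂ = begin
      cutSize (S₁ ++ take k S₂) (edges T₁) + cutSize (S₁ ++ take k S₂) (branch (root T₁) T₂)
        ≡⟨ cong (_+ cutSize (S₁ ++ take k S₂) (branch (root T₁) T₂)) (cutSize-edges≡0 T₁ (∈-++⁺ˡ ∘ ∈-serialization ser₁)) ⟩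
      cutSize (S₁ ++ take k S₂) (branch (root T₁) T₂)
        ≤⟨ cutSize-branch≤width (root T₁) T₂ ser₂ k<S₂ (AgreeOn-++ ∉S₁) ⟩
      dcwS T₂ S₂ ⊔ 1
        ≤⟨ ⊔-lub (m≤n⊔m (suc (dcwS T₁ S₁)) (dcwS T₂ S₂))
                 (≤-trans (s≤s z≤n) (m≤m⊔n (suc (dcwS T₁ S₁)) (dcwS T₂ S₂))) ⟩
      suc (dcwS T₁ S₁) ⊔ dcwS T₂ S₂ ∎
      where
      k<S₂ : k < length S₂
      k<S₂ = +-cancelˡ-< (length S₁) k (length S₂) (subst (length S₁ + k <_) (length-++ S₁) i<n)

-- The lower bound

module LowerBound {r : ℕ} {ts : List Tree} {T₂ : Tree}
  (T₁! : WellFormed (node r ts)) (T₂! : WellFormed T₂) (disjoint : Disjoint (vertices (node r ts)) (vertices T₂))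
  {w₁ w₂ : ℕ} (opt₁ : IsDCW (node r ts) w₁) (opt₂ : IsDCW T₂ w₂)
  (children≤w₂ : ∀ C → C ∈ ts → ∀ c → IsDCW C c → c ≤ w₂)
  {S : List ℕ} (ser : Serialization (attach (node r ts) T₂) S) where

  private
    T₁ T : Tree
    T₁ = node r ts
    T  = attach T₁ T₂

    D : ℕ
    D = dcwS T S

    ∈S₁ : ∀ {x} → x ∈ vertices T₁ → x ∈ S
    ∈S₁ = ∈-serialization {T} ser ∘ ∈-vertices-attach⁺ {T₁} ∘ inj₁

    ∈S₂ : ∀ {x} → x ∈ vertices T₂ → x ∈ S
    ∈S₂ = ∈-serialization {T} ser ∘ ∈-vertices-attach⁺ {T₁} ∘ inj₂

    S! : Unique S
    S! = serialization-unique {T} ser (subst Unique (sym (vertices-attach T₁ T₂)) (Unique.++⁺ T₁! T₂! disjoint))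

    cutSize≤D : ∀ {i} → 0 < i → i < length S → cutSize (take i S) (edges T₁) + cutSize (take i S) (branch r T₂) ≤ D
    cutSize≤D {i} 0<i i<S = subst (_≤ D) (trans (cut≡cutSize {T} ser i) (cutSize-attach {T₁} {T₂} (take i S)))
      (cut≤dcwS T S 0<i (subst (i <_) (serialization-length {T} ser) i<S))

    S₂ : List ℕ
    S₂ = filter (_∈? vertices T₂) S

    ser₂ : Serialization T₂ S₂
    ser₂ = restrict T₂ S! T₂! ∈S₂ (λ v w e∈ → proj₂ ser v w (∈-edges-attach⁺ {T₁} (inj₂ (there e∈))))

    peak : ∀ {w} → IsDCW T₂ w → ∃ λ p → 0 < p × p < length S × w ⊔ 1 ≤ cutSize (take p S) (branch r T₂)
    peak {zero} _ =
      let 0<p , p<S , r∈ , r₂∉ = forward-gap S (∈S₁ (here refl)) (∈S₂ (root∈vertices T₂))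
                                   (proj₂ ser r (root T₂) (∈-edges-attach⁺ {T₁} (inj₂ (here refl))))
      in pos S r , 0<p , p<S , cutSize>0 (take (pos S r) S) (here refl) (r∈ , r₂∉)
    peak {suc w} opt with dcwS-attained T₂ S₂ (≤-trans (s≤s z≤n) (proj₂ opt S₂ ser₂))
    ... | j , 0<j , j<V₂ , attained
          with take-filter (_∈? vertices T₂) S (subst (j <_) (sym (serialization-length {T₂} ser₂)) j<V₂)
    ... | G , G<S , j≤G , take-j≡ = G , <-≤-trans 0<j j≤G , G<S , (begin
      suc w ⊔ 1                                          ≡⟨ cong suc (⊔-identityʳ w) ⟩
      suc w                                              ≤⟨ proj₂ opt S₂ ser₂ ⟩
      dcwS T₂ S₂                                         ≡⟨ attained ⟩
      cut T₂ S₂ j                                        ≡⟨ cut≡cutSize {T₂} ser₂ j ⟩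
      cutSize (take j S₂) (edges T₂)                     ≡⟨ cong (λ Y → cutSize Y (edges T₂)) take-j≡ ⟩
      cutSize (filter (_∈? vertices T₂) (take G S)) (edges T₂)
        ≡⟨ cutSize-cong (edges T₂) (edges-within T₂) (AgreeOn-filter (vertices T₂) (take G S)) ⟩
      cutSize (take G S) (edges T₂)                      ≤⟨ m≤n+m _ (cutSize (take G S) ((r , root T₂) ∷ [])) ⟩
      cutSize (take G S) ((r , root T₂) ∷ []) + cutSize (take G S) (edges T₂) ≡⟨ cutSize-branch r T₂ ⟨
      cutSize (take G S) (branch r T₂)                   ∎)
      where open ≤-Reasoning

    module AtPeak {p : ℕ} (0<p : 0 < p) (p<S : p < length S) (peak-cut : w₂ ⊔ 1 ≤ cutSize (take p S) (branch r T₂)) where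

      X : List ℕ
      X = take p S

      r∈X : r ∈ X
      r∈X = root∈take {T} ser 0<p

      finished? : Decidable (λ C → All (_∈ X) (vertices C))
      finished? C = All.all? (_∈? X) (vertices C)

      F U : List Tree
      F = filter finished? ts
      U = filter (¬? ∘ finished?) ts

      F⊆ts : ∀ {C} → C ∈ F → C ∈ ts
      F⊆ts = proj₁ ∘ ∈-filter⁻ finished? {xs = ts}

      U⊆ts : ∀ {C} → C ∈ U → C ∈ ts
      U⊆ts = proj₁ ∘ ∈-filter⁻ (¬? ∘ finished?) {xs = ts}

      unfinished : ∀ {C} → C ∈ U → ∃ λ x → x ∈ vertices C × x ∉ X
      unfinished {C} C∈U = find (¬All⇒Any¬ (_∈? X) (vertices C) (proj₂ (∈-filter⁻ (¬? ∘ finished?) {xs = ts} C∈U)))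

      T₂-unfinished : ∃ λ x → x ∈ vertices T₂ × x ∉ X
      T₂-unfinished with cutSize>0⇒Leaves X (branch r T₂) (≤-trans (m≤n⊔m w₂ 1) peak-cut)
      ... | e , e∈ , _ , v∉X = proj₂ e , branch-target r T₂ e∈ , v∉X

      cutSize-T₁ : ∀ Y → cutSize Y (edges T₁) ≡ cutSize Y (branches r F) + cutSize Y (branches r U)
      cutSize-T₁ Y = begin
        cutSize Y (edges T₁)                           ≡⟨ cutSize-↭ Y (edges↭branches r ts) ⟩
        cutSize Y (branches r ts)                      ≡⟨ cutSize-↭ Y (concatMap-↭ (branch r) (filter-partition-↭ finished? ts)) ⟩
        cutSize Y (branches r (F ++ U))                ≡⟨ cong (cutSize Y) (concatMap-++ (branch r) F U) ⟩
        cutSize Y (branches r F ++ branches r U)       ≡⟨ cutSize-++ Y (branches r F) (branches r U) ⟩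
        cutSize Y (branches r F) + cutSize Y (branches r U) ∎
        where open ≡-Reasoning

      VA : List ℕ
      VA = vertices (node r F)

      T₁↭ : vertices T₁ ↭ VA ++ verticesF U
      T₁↭ = prep r (↭-trans (verticesF-↭ (filter-partition-↭ finished? ts)) (↭-reflexive (verticesF-++ F U)))

      VA! : Unique VA
      VA! = proj₁ (Unique-++⁻ VA (Unique-resp-↭ T₁↭ T₁!))

      U! : Unique (verticesF U)
      U! = proj₁ (proj₂ (Unique-++⁻ VA (Unique-resp-↭ T₁↭ T₁!)))

      VA∩U=∅ : Disjoint VA (verticesF U)
      VA∩U=∅ = proj₂ (proj₂ (Unique-++⁻ VA (Unique-resp-↭ T₁↭ T₁!)))

      peak-bound : w₂ ⊔ 1 + length U ≤ D
      peak-bound = begin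
        w₂ ⊔ 1 + length U                                     ≤⟨ +-mono-≤ peak-cut U-cut ⟩
        cutSize X (branch r T₂) + cutSize X (branches r U)    ≤⟨ +-monoʳ-≤ (cutSize X (branch r T₂)) (m≤n+m _ (cutSize X (branches r F))) ⟩
        cutSize X (branch r T₂) + (cutSize X (branches r F) + cutSize X (branches r U)) ≡⟨ cong (cutSize X (branch r T₂) +_) (cutSize-T₁ X) ⟨
        cutSize X (branch r T₂) + cutSize X (edges T₁)        ≡⟨ +-comm (cutSize X (branch r T₂)) (cutSize X (edges T₁)) ⟩
        cutSize X (edges T₁) + cutSize X (branch r T₂)        ≤⟨ cutSize≤D 0<p p<S ⟩
        D                                                     ∎
        where
        open ≤-Reasoning
        U-cut : length U ≤ cutSize X (branches r U)
        U-cut = length≤cutSize-branches r U λ {C} C∈U →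
          let x , x∈C , x∉X = unfinished C∈U in cutSize-branch>0 r C r∈X x∈C x∉X

      VA⊆X : ∀ {x} → x ∈ VA → x ∈ X
      VA⊆X (here refl) = r∈X
      VA⊆X (there x∈F) = let C , C∈F , x∈C = ∈-verticesF⁻ x∈F in
        All.lookup (proj₂ (∈-filter⁻ finished? {xs = ts} C∈F)) x∈C

      A : List ℕ
      A = filter (_∈? VA) X

      A-ser : Serialization (node r F) A
      A-ser = restrict (node r F) (Unique.take⁺ p S!) VA! VA⊆X λ v w e∈ →
        let v∈ , w∈ = edges-within (node r F) e∈ in
        subst₂ _<_ (sym (pos-take p S (VA⊆X v∈))) (sym (pos-take p S (VA⊆X w∈)))
          (proj₂ ser v w (∈-edges-attach⁺ {T₁} (inj₁ (edges-node-⊆ F⊆ts e∈))))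

      VA⊆A : ∀ {x} → x ∈ VA → x ∈ A
      VA⊆A = ∈-serialization {node r F} A-ser

      U∉A : ∀ {x} → x ∈ verticesF U → x ∉ A
      U∉A x∈U x∈A = VA∩U=∅ (proj₂ (∈-filter⁻ (_∈? VA) {xs = X} x∈A) , x∈U)

      block : ∀ {C} → C ∈ ts → Serialization≤ w₂ C
      block {C} C∈ts =
        let c , opt = IsDCW-exists C (restrict C S! (child-wellFormed T₁! C∈ts) C⊆S forward)
            s , s-ser , s≡c = proj₁ opt
        in s , s-ser , subst (_≤ w₂) (sym s≡c) (children≤w₂ C C∈ts c opt)
        where
        C⊆S : ∀ {x} → x ∈ vertices C → x ∈ S
        C⊆S = ∈S₁ ∘ there ∘ ∈-verticesF⁺ C∈ts
        forward : Forward (edges C) S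
        forward v w e∈ = proj₂ ser v w (∈-edges-attach⁺ {T₁} (inj₁ (∈-edges⁺ C∈ts (there e∈))))

      blocks : All (Serialization≤ w₂) U
      blocks = All.tabulate (block ∘ U⊆ts)

      R : List ℕ
      R = joined blocks

      S* : List ℕ
      S* = A ++ R

      S*-ser : Serialization T₁ S*
      S*-ser = ↭-trans (++⁺ (proj₁ A-ser) (joined-↭ blocks)) (↭-sym T₁↭) , forward
        where
        ∈R : ∀ {x} → x ∈ verticesF U → x ∈ R
        ∈R = ∈-resp-↭ (↭-sym (joined-↭ blocks))
        forward-branch : ∀ {C v w} → C ∈ ts → Dec (All (_∈ X) (vertices C)) → (v , w) ∈ branch r C → pos S* v < pos S* w
        forward-branch {C} {v} {w} C∈ts (yes fin) e∈C =
          let e∈F = ∈-edges⁺ (∈-filter⁺ finished? C∈ts fin) e∈C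
              v∈ , w∈ = edges-within (node r F) e∈F
          in subst₂ _<_ (sym (pos-++ˡ A R (VA⊆A v∈))) (sym (pos-++ˡ A R (VA⊆A w∈))) (proj₂ A-ser v w e∈F)
        forward-branch {C} C∈ts (no unfin) (here refl) =
          let rC∈U = ∈-verticesF⁺ (∈-filter⁺ (¬? ∘ finished?) C∈ts unfin) (root∈vertices C)
          in pos-++-< A R (VA⊆A (here refl)) (U∉A rC∈U) (∈R rC∈U)
        forward-branch {C} {v} {w} C∈ts (no unfin) (there e∈C) =
          let C∈U = ∈-filter⁺ (¬? ∘ finished?) C∈ts unfin
              v∈ , w∈ = edges-within C e∈C
          in subst₂ _<_ (sym (pos-++ʳ A R (U∉A (∈-verticesF⁺ C∈U v∈))))
                        (sym (pos-++ʳ A R (U∉A (∈-verticesF⁺ C∈U w∈))))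
               (+-monoʳ-< (length A) (joined-forward blocks U! C∈U v w e∈C))
        forward : Forward (edges T₁) S*
        forward v w e∈ = let C , C∈ts , e∈C = ∈-edges⁻ e∈ in forward-branch C∈ts (finished? C) e∈C

      gap-in-A : ∀ {i} → 0 < i → i < length A → suc (cutSize (take i A) (edges T₁)) ≤ D
      gap-in-A {i} 0<i i<A with take-filter (_∈? VA) X i<A
      ... | G , G<X , i≤G , take-i≡ = begin
        suc (cutSize Z (edges T₁))                                ≡⟨ cong suc (cutSize-T₁ Z) ⟩
        suc (cutSize Z (branches r F) + cutSize Z (branches r U)) ≤⟨ s≤s (+-mono-≤ (≤-reflexive F-same) U-≤) ⟩
        suc (cutSize Y (branches r F) + length U)                 ≡⟨ +-comm 1 _ ⟩
        cutSize Y (branches r F) + length U + 1                   ≤⟨ +-mono-≤ (+-monoʳ-≤ (cutSize Y (branches r F)) U≤) 1≤T₂ ⟩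
        cutSize Y (branches r F) + cutSize Y (branches r U) + cutSize Y (branch r T₂)
          ≡⟨ cong (_+ cutSize Y (branch r T₂)) (cutSize-T₁ Y) ⟨
        cutSize Y (edges T₁) + cutSize Y (branch r T₂)            ≤⟨ cutSize≤D (<-≤-trans 0<i i≤G) (≤-<-trans G≤p p<S) ⟩
        D                                                         ∎
        where
        open ≤-Reasoning
        Z Y : List ℕ
        Z = take i A
        Y = take G S
        G≤p : G ≤ p
        G≤p = ≤-trans (<⇒≤ G<X) (subst (_≤ p) (sym (length-take p S)) (m⊓n≤m p (length S)))
        Y⊆X : ∀ {x} → x ∈ Y → x ∈ X
        Y⊆X = ∈-take-≤ S G≤p
        r∈Y : r ∈ Y
        r∈Y = root∈take {T} ser (<-≤-trans 0<i i≤G)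
        F-same : cutSize Z (branches r F) ≡ cutSize Y (branches r F)
        F-same = trans (cong (λ Z → cutSize Z (branches r F)) (trans take-i≡ (cong (filter (_∈? VA)) (take-take-≤ S G≤p))))
          (cutSize-cong (branches r F) (edges-within (node r F) ∘ ∈-resp-↭ (↭-sym (edges↭branches r F))) (AgreeOn-filter VA Y))
        U-≤ : cutSize Z (branches r U) ≤ length U
        U-≤ = cutSize-branches≤length r U λ {C} C∈U →
          cutSize-branch≤1 r C λ x∈C x∈Z → U∉A (∈-verticesF⁺ C∈U x∈C) (∈-take⁻ i A x∈Z)
        U≤ : length U ≤ cutSize Y (branches r U)
        U≤ = length≤cutSize-branches r U λ {C} C∈U →
          let x , x∈C , x∉X = unfinished C∈U in cutSize-branch>0 r C r∈Y x∈C (x∉X ∘ Y⊆X)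
        1≤T₂ : 1 ≤ cutSize Y (branch r T₂)
        1≤T₂ = let x , x∈T₂ , x∉X = T₂-unfinished in cutSize-branch>0 r T₂ r∈Y x∈T₂ (x∉X ∘ Y⊆X)

      gap-in-R : ∀ {k} → k < length R → suc (cutSize (A ++ take k R) (edges T₁)) ≤ D
      gap-in-R {k} k<R = begin
        suc (cutSize Z (edges T₁))                                ≡⟨ cong suc (cutSize-T₁ Z) ⟩
        suc (cutSize Z (branches r F) + cutSize Z (branches r U)) ≡⟨ cong (λ n → suc (n + cutSize Z (branches r U))) F-done ⟩
        suc (cutSize Z (branches r U))                            ≤⟨ cutSize-joined r blocks U! U∉A k<R ⟩
        w₂ ⊔ 1 + length U                                         ≤⟨ peak-bound ⟩
        D                                                         ∎
        where
        open ≤-Reasoning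
        Z : List ℕ
        Z = A ++ take k R
        F-done : cutSize Z (branches r F) ≡ 0
        F-done = cutSize-branches≡0 r F λ {C} C∈F →
          cutSize-branch≡0 r C λ x∈C → ∈-++⁺ˡ (VA⊆A (there (∈-verticesF⁺ C∈F x∈C)))

      S*-gap : ∀ {i} → 0 < i → i < length S* → suc (cut T₁ S* i) ≤ D
      S*-gap {i} 0<i i<S* = subst (λ n → suc n ≤ D) (sym (cut≡cutSize {T₁} S*-ser i)) (prefix-bound 0<i (split (length A) i) i<S*)
        where
        prefix-bound : ∀ {i} → 0 < i → Split (length A) i → i < length S* → suc (cutSize (take i S*) (edges T₁)) ≤ D
        prefix-bound 0<i (below i<A) _ =
          subst (λ Z → suc (cutSize Z (edges T₁)) ≤ D) (sym (take-++ˡ A R (<⇒≤ i<A))) (gap-in-A 0<i i<A)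
        prefix-bound _ (above k) i<S* =
          subst (λ Z → suc (cutSize Z (edges T₁)) ≤ D) (sym (take-++ʳ k A R))
            (gap-in-R (+-cancelˡ-< (length A) k (length R) (subst (length A + k <_) (length-++ A) i<S*)))

      suc-w₁≤D : suc w₁ ≤ D
      suc-w₁≤D = m≤pred[n]⇒suc[m]≤n {{>-nonZero 0<D}} (≤-trans (proj₂ opt₁ S* S*-ser) (dcwS-lub T₁ S* λ {i} 0<i i<V₁ →
        suc[m]≤n⇒m≤pred[n] (S*-gap 0<i (subst (i <_) (sym (serialization-length {T₁} S*-ser)) i<V₁))))
        where
        0<D : 0 < D
        0<D = ≤-trans (≤-trans (m≤n⊔m w₂ 1) (m≤m+n (w₂ ⊔ 1) (length U))) peak-bound

  dcwS-attach≥ : suc w₁ ⊔ w₂ ≤ dcwS (attach (node r ts) T₂) S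
  dcwS-attach≥ with peak opt₂
  ... | p , 0<p , p<S , peak-cut = ⊔-lub (AtPeak.suc-w₁≤D 0<p p<S peak-cut)
    (≤-trans (≤-trans (m≤m⊔n w₂ 1) (m≤m+n (w₂ ⊔ 1) _)) (AtPeak.peak-bound 0<p p<S peak-cut))

lemma1 : (T₁ T₂ : Tree) → WellFormed T₁ → WellFormed T₂
    → (∀ v → v ∈ vertices T₁ → v ∉ vertices T₂)
    → (S₁ S₂ : List ℕ) → (w₁ w₂ : ℕ)
    → Serialization T₁ S₁ → IsDCW T₁ w₁ → dcwS T₁ S₁ ≡ w₁
    → Serialization T₂ S₂ → IsDCW T₂ w₂ → dcwS T₂ S₂ ≡ w₂
    → (∀ C → C ∈ children T₁ → ∀ c → IsDCW C c → c ≤ w₂)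
    → IsDCW (attach T₁ T₂) (suc w₁ ⊔ w₂)
      × Serialization (attach T₁ T₂) (S₁ ++ S₂)
      × dcwS (attach T₁ T₂) (S₁ ++ S₂) ≡ suc w₁ ⊔ w₂
lemma1 (node r ts) T₂ T₁! T₂! disj S₁ S₂ w₁ w₂ ser₁ opt₁ refl ser₂ opt₂ refl children≤w₂ =
  ((S₁ ++ S₂ , ser , dcwS≡) , lower-bound) , ser , dcwS≡
  where
  disjoint : Disjoint (vertices (node r ts)) (vertices T₂)
  disjoint (v∈T₁ , v∈T₂) = disj _ v∈T₁ v∈T₂
  lower-bound : ∀ S → Serialization (attach (node r ts) T₂) S → suc w₁ ⊔ w₂ ≤ dcwS (attach (node r ts) T₂) S
  lower-bound S = LowerBound.dcwS-attach≥ {r} {ts} {T₂} T₁! T₂! disjoint opt₁ opt₂ children≤w₂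
  ser : Serialization (attach (node r ts) T₂) (S₁ ++ S₂)
  ser = serialization-attach {node r ts} {T₂} disjoint ser₁ ser₂
  dcwS≡ : dcwS (attach (node r ts) T₂) (S₁ ++ S₂) ≡ suc w₁ ⊔ w₂
  dcwS≡ = ≤-antisym (dcwS-attach≤ {node r ts} {T₂} disjoint ser₁ ser₂) (lower-bound (S₁ ++ S₂) ser)
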